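{- Let $n\ge 1$ and $m\ge 3$, and let $W_{n,m}$ be the join of the edgeless graph $\overline{K_n}$ on $n$ vertices and the cycle $C_m$ (i.e., every vertex of $\overline{K_n}$ is joined to every vertex of $C_m$). Then player B wins the general position avoidance game on $W_{n,m}$ if and only if $m\ge 4$.
   Context: All graphs are finite and simple. A set $S$ of vertices of a graph $G$ is a general position set if no three distinct vertices of $S$ lie on a common shortest path (geodesic) of $G$. In the general position avoidance game on $G$, two players A and B alternately select vertices of $G$, with A moving first; a selection is legal if the vertex was not selected before and the set of all vertices selected so far is a general position set of $G$. The game ends when no legal move remains; the player who selects the last vertex loses. "Player X wins" means X has a winning strategy. -}

module Defs where

open import Data.Nat using (ℕ; zero; suc; _+_; _<_; _%_)
open import Data.Fin using (Fin; toℕ; splitAt)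
open import Data.Bool using (Bool; true; false; _∨_)
open import Data.Sum using (_⊎_; inj₁; inj₂)
open import Data.Product using (Σ; _×_; ∃; ∃-syntax)
open import Data.List using (List; []; _∷_)
open import Data.List.Membership.Propositional using (_∈_; _∉_)
open import Relation.Binary.PropositionalEquality using (_≡_; _≢_)
open import Relation.Nullary using (¬_)
open import Data.Nat using (_≡ᵇ_)

-- A finite graph on vertex set Fin V with Boolean adjacency
-- (for W n m with m ≥ 3 it is symmetric and loopless, i.e. simple).
record Graph : Set where
  field
    V     : ℕ
    adj   : Fin V → Fin V → Bool
open Graph public

module _ (G : Graph) where

  data Walk : Fin (V G) → Fin (V G) → ℕ → Set where
    nil  : ∀ {x} → Walk x x 0
    cons : ∀ {x y z k} → adj G x y ≡ true → Walk y z k → Walk x z (suc k)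

  data OnWalk (u : Fin (V G)) : ∀ {x y k} → Walk x y k → Set where
    here-nil  : OnWalk u (nil {u})
    here-cons : ∀ {y z k} (e : adj G u y ≡ true) (w : Walk y z k) → OnWalk u (cons e w)
    there     : ∀ {x y z k} (e : adj G x y ≡ true) {w : Walk y z k} → OnWalk u w → OnWalk u (cons e w)

  IsGeodesic : ∀ {x y k} → Walk x y k → Set
  IsGeodesic {x} {y} {k} _ = ∀ j → j < k → ¬ Walk x y j

  OnCommonGeodesic : Fin (V G) → Fin (V G) → Fin (V G) → Set
  OnCommonGeodesic a b c =
    ∃[ x ] ∃[ y ] ∃[ k ] Σ (Walk x y k) λ w →
      IsGeodesic w × OnWalk a w × OnWalk b w × OnWalk c w

  GeneralPosition : List (Fin (V G)) → Set
  GeneralPosition S = ∀ a b c → a ∈ S → b ∈ S → c ∈ S →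
    a ≢ b → b ≢ c → a ≢ c → ¬ OnCommonGeodesic a b c

  Legal : List (Fin (V G)) → Fin (V G) → Set
  Legal S v = v ∉ S × GeneralPosition (v ∷ S)

  -- the player to move from position S wins / loses (misère: selecting
  -- the last vertex loses, so a player with no legal move wins)
  mutual
    data ToMoveWins (S : List (Fin (V G))) : Set where
      terminal : (∀ v → ¬ Legal S v) → ToMoveWins S
      move     : ∀ v → Legal S v → ToMoveLoses (v ∷ S) → ToMoveWins S

    data ToMoveLoses (S : List (Fin (V G))) : Set where
      stuck : (∃[ v ] Legal S v) → (∀ v → Legal S v → ToMoveWins (v ∷ S)) → ToMoveLoses S

  -- A moves first from the empty position; B wins iff A (to move) loses
  BWins : Set
  BWins = ToMoveLoses []

cycAdj : (m : ℕ) → Fin m → Fin m → Bool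
cycAdj zero    () _
cycAdj (suc p) j k = ((suc (toℕ j) % suc p) ≡ᵇ toℕ k) ∨ ((suc (toℕ k) % suc p) ≡ᵇ toℕ j)

joinAdj : (n m : ℕ) → Fin (n + m) → Fin (n + m) → Bool
joinAdj n m x y with splitAt n x | splitAt n y
... | inj₁ _ | inj₁ _ = false
... | inj₁ _ | inj₂ _ = true
... | inj₂ _ | inj₁ _ = true
... | inj₂ j | inj₂ k = cycAdj m j k

W : ℕ → ℕ → Graph
W n m = record { V = n + m ; adj = joinAdj n m }

{-# OPTIONS --safe #-}
module Submission where

-- Call the vertices of the edgeless part hubs and those of C_m the rim.  W n m has diameter 2,
-- so a triangle never lies on a common geodesic while an induced path a – b – c does; hence
-- cliques are in general position, whereas two hubs with a rim vertex, or a hub with two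
-- non-adjacent rim vertices, are not.  For m ≥ 4, B answers A's first vertex with one of the
-- other kind: A can still add a rim neighbour, but then nothing can be added, since a new vertex
-- would be a second hub or would close a triangle in C_m.  For m = 3, A starts on the rim and
-- completes a hub and two rim vertices; B must take the last rim vertex and nothing can follow.

open import Defs
open import Data.Nat using (ℕ; suc; _+_; _<_; _≤_; _%_; _≡ᵇ_; s≤s; z≤n)
open import Data.Nat.Properties using (m≤n⇒m<n∨m≡n; ≡ᵇ⇒≡; ≡⇒≡ᵇ; <-irrefl; suc-injective; m≤m+n)
open import Data.Nat.DivMod using (m<n⇒m%n≡m; n%n≡0; m%n<n)
open import Data.Fin using (Fin; toℕ; fromℕ<; splitAt; _↑ˡ_; _↑ʳ_)
open import Data.Fin.Patterns using (0F; 1F; 2F)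
open import Data.Fin.Properties using (toℕ<n; toℕ-injective; toℕ-fromℕ<; splitAt-↑ˡ; splitAt-↑ʳ; splitAt⁻¹-↑ˡ; splitAt⁻¹-↑ʳ; ↑ˡ-injective; ↑ʳ-injective)
import Data.Fin.Properties as Fin
open import Data.Bool using (true; false)
open import Data.Bool.Properties using (∨-comm; T-≡; T-∨)
open import Data.Sum using (_⊎_; inj₁; inj₂; [_,_]′)
open import Data.Product using (∃; _,_)
open import Data.List using (List; []; _∷_)
open import Data.List.Membership.Propositional using (_∈_; _∉_)
open import Data.List.Relation.Unary.Any using (here; there)
open import Data.List.Relation.Unary.All using ([]; _∷_)
import Data.List.Relation.Unary.All as All
open import Data.List.Relation.Unary.All.Properties using (All¬⇒¬Any)
open import Data.List.Relation.Unary.AllPairs using (AllPairs; []; _∷_)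
open import Data.Empty using (⊥-elim)
open import Function using (_∘_)
open import Function.Bundles using (_⇔_; mk⇔; Equivalence)
open import Relation.Nullary using (¬_; yes; no)
open import Relation.Binary.PropositionalEquality using (_≡_; _≢_; refl; sym; trans; cong; subst; ≢-sym)

Adj : (G : Graph) → Fin (V G) → Fin (V G) → Set
Adj G x y = adj G x y ≡ true

∉⇒≢ : ∀ {A : Set} {x y : A} {S : List A} → x ∉ S → y ∈ S → x ≢ y
∉⇒≢ x∉S y∈S refl = x∉S y∈S

module _ {G : Graph} where

  wins⇒¬loses : ∀ {S} → ToMoveWins G S → ¬ ToMoveLoses G S
  wins⇒¬loses (terminal none) (stuck (v , legal) _) = none v legal
  wins⇒¬loses (move v legal loses) (stuck _ reply) = wins⇒¬loses (reply v legal) loses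

  loses-in-one : ∀ {S} → ∃ (Legal G S) → (∀ u v → Legal G S u → ¬ Legal G (u ∷ S) v) →
                 ToMoveLoses G S
  loses-in-one legal blocked = stuck legal λ u legal-u → terminal λ v → blocked u v legal-u

  path-onCommonGeodesic : ∀ {a b c} → Adj G a b → Adj G b c → adj G a c ≡ false → a ≢ c →
                          OnCommonGeodesic G a b c
  path-onCommonGeodesic a∼b b∼c a≁c a≢c =
    _ , _ , 2 , cons a∼b (cons b∼c nil) , shortest ,
    here-cons a∼b _ , there a∼b (here-cons b∼c nil) , there a∼b (there b∼c here-nil)
    where
    shortest : IsGeodesic G (cons a∼b (cons b∼c nil))
    shortest 0 _ nil = a≢c refl
    shortest 1 _ (cons a∼c nil) with () ← trans (sym a∼c) a≁c
    shortest (suc (suc _)) (s≤s (s≤s ())) _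

  path-¬generalPosition : ∀ {S a b c} → a ∈ S → b ∈ S → c ∈ S → a ≢ b → b ≢ c → a ≢ c →
                          Adj G a b → Adj G b c → adj G a c ≡ false → ¬ GeneralPosition G S
  path-¬generalPosition a∈ b∈ c∈ a≢b b≢c a≢c a∼b b∼c a≁c gp =
    gp _ _ _ a∈ b∈ c∈ a≢b b≢c a≢c (path-onCommonGeodesic a∼b b∼c a≁c a≢c)

module DiameterTwo {G : Graph} (adj-sym : ∀ {x y} → Adj G x y → Adj G y x)
         (walk≤2 : ∀ x y → Walk G x y 1 ⊎ Walk G x y 2) where

  private
    onEdge : ∀ {u x y} {e : Adj G x y} → OnWalk G u (cons e nil) → u ≡ x ⊎ u ≡ y
    onEdge (here-cons _ _) = inj₁ refl
    onEdge (there _ here-nil) = inj₂ refl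

    onMiddle : ∀ {u v x z y} {e₁ : Adj G x z} {e₂ : Adj G z y} → ¬ Adj G x y →
               OnWalk G u (cons e₁ (cons e₂ nil)) → OnWalk G v (cons e₁ (cons e₂ nil)) →
               u ≢ v → Adj G u v → u ≡ z ⊎ v ≡ z
    onMiddle _ (there _ (here-cons _ _)) _ _ _ = inj₁ refl
    onMiddle _ _ (there _ (here-cons _ _)) _ _ = inj₂ refl
    onMiddle _ (here-cons _ _) (here-cons _ _) u≢v _ = ⊥-elim (u≢v refl)
    onMiddle _ (there _ (there _ here-nil)) (there _ (there _ here-nil)) u≢v _ = ⊥-elim (u≢v refl)
    onMiddle x≁y (here-cons _ _) (there _ (there _ here-nil)) _ u∼v = ⊥-elim (x≁y u∼v)
    onMiddle x≁y (there _ (there _ here-nil)) (here-cons _ _) _ u∼v = ⊥-elim (x≁y (adj-sym u∼v))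

  triangle-¬onCommonGeodesic : ∀ {a b c} → Adj G a b → Adj G b c → Adj G a c →
                               a ≢ b → b ≢ c → a ≢ c → ¬ OnCommonGeodesic G a b c
  triangle-¬onCommonGeodesic _ _ _ a≢b _ _ (_ , _ , 0 , nil , _ , here-nil , here-nil , _) = a≢b refl
  triangle-¬onCommonGeodesic _ _ _ a≢b b≢c a≢c (_ , _ , 1 , cons _ nil , _ , oa , ob , oc)
    with onEdge oa | onEdge ob | onEdge oc
  ... | inj₁ refl | inj₁ refl | _ = a≢b refl
  ... | inj₂ refl | inj₂ refl | _ = a≢b refl
  ... | inj₁ refl | _ | inj₁ refl = a≢c refl
  ... | inj₂ refl | _ | inj₂ refl = a≢c refl
  ... | _ | inj₁ refl | inj₁ refl = b≢c refl
  ... | _ | inj₂ refl | inj₂ refl = b≢c refl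
  triangle-¬onCommonGeodesic a∼b b∼c a∼c a≢b b≢c a≢c (_ , _ , 2 , cons _ (cons _ nil) , geo , oa , ob , oc)
    with onMiddle x≁y oa ob a≢b a∼b | onMiddle x≁y ob oc b≢c b∼c | onMiddle x≁y oa oc a≢c a∼c
    where x≁y = λ x∼y → geo 1 (s≤s (s≤s z≤n)) (cons x∼y nil)
  ... | inj₁ refl | inj₁ refl | _ = a≢b refl
  ... | inj₁ refl | inj₂ refl | _ = a≢c refl
  ... | inj₂ refl | inj₂ refl | _ = b≢c refl
  ... | inj₂ refl | inj₁ refl | inj₁ refl = a≢b refl
  ... | inj₂ refl | inj₁ refl | inj₂ refl = b≢c refl
  triangle-¬onCommonGeodesic _ _ _ _ _ _ (x , y , suc (suc (suc _)) , _ , geo , _) =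
    [ geo 1 (s≤s (s≤s z≤n)) , geo 2 (s≤s (s≤s (s≤s z≤n))) ]′ (walk≤2 x y)

  private
    pairwise-adj : ∀ {S a b} → AllPairs (Adj G) S → a ∈ S → b ∈ S → a ≢ b → Adj G a b
    pairwise-adj (_ ∷ _) (here refl) (here refl) a≢b = ⊥-elim (a≢b refl)
    pairwise-adj (a∼S ∷ _) (here refl) (there b∈) _ = All.lookup a∼S b∈
    pairwise-adj (b∼S ∷ _) (there a∈) (here refl) _ = adj-sym (All.lookup b∼S a∈)
    pairwise-adj (_ ∷ clique) (there a∈) (there b∈) a≢b = pairwise-adj clique a∈ b∈ a≢b

  clique-generalPosition : ∀ {S} → AllPairs (Adj G) S → GeneralPosition G S
  clique-generalPosition clique a b c a∈ b∈ c∈ a≢b b≢c a≢c =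
    triangle-¬onCommonGeodesic (pairwise-adj clique a∈ b∈ a≢b) (pairwise-adj clique b∈ c∈ b≢c)
      (pairwise-adj clique a∈ c∈ a≢c) a≢b b≢c a≢c

  clique-legal : ∀ {S v} → v ∉ S → AllPairs (Adj G) (v ∷ S) → Legal G S v
  clique-legal v∉S clique = v∉S , clique-generalPosition clique

data Next (m : ℕ) : ℕ → ℕ → Set where
  step : ∀ {a} → suc a < m → Next m a (suc a)
  wrap : ∀ {a} → suc a ≡ m → Next m a 0

Next-% : ∀ {p a} → a < suc p → Next (suc p) a (suc a % suc p)
Next-% {p} {a} a<m with m≤n⇒m<n∨m≡n a<m
... | inj₁ 1+a<m = subst (Next _ a) (sym (m<n⇒m%n≡m 1+a<m)) (step 1+a<m)
... | inj₂ refl = subst (Next _ a) (sym (n%n≡0 (suc p))) (wrap refl)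

Next-functional : ∀ {m a b c} → Next m a b → Next m a c → b ≡ c
Next-functional (step _) (step _) = refl
Next-functional (step 1+a<m) (wrap 1+a≡m) = ⊥-elim (<-irrefl 1+a≡m 1+a<m)
Next-functional (wrap 1+a≡m) (step 1+a<m) = ⊥-elim (<-irrefl 1+a≡m 1+a<m)
Next-functional (wrap _) (wrap _) = refl

Next-injective : ∀ {m a b c} → Next m a c → Next m b c → a ≡ b
Next-injective (step _) (step _) = refl
Next-injective (wrap 1+a≡m) (wrap 1+b≡m) = suc-injective (trans 1+a≡m (sym 1+b≡m))

Next-irreflexive : ∀ {p a} → ¬ Next (2 + p) a a
Next-irreflexive (wrap ())

Next-¬3-cycle : ∀ {p a b c} → Next (4 + p) a b → Next (4 + p) b c → ¬ Next (4 + p) c a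
Next-¬3-cycle (step _) (step _) (wrap ())
Next-¬3-cycle (step _) (wrap ()) (step _)
Next-¬3-cycle (wrap ()) (step _) (step _)
Next-¬3-cycle (wrap refl) (wrap ()) _

private
  module ⇔ = Equivalence

cycAdj⇒Next : ∀ {p} (j k : Fin (suc p)) → cycAdj (suc p) j k ≡ true →
              Next (suc p) (toℕ j) (toℕ k) ⊎ Next (suc p) (toℕ k) (toℕ j)
cycAdj⇒Next j k j∼k with ⇔.to T-∨ (⇔.from T-≡ j∼k)
... | inj₁ succ-j = inj₁ (subst (Next _ _) (≡ᵇ⇒≡ _ _ succ-j) (Next-% (toℕ<n j)))
... | inj₂ succ-k = inj₂ (subst (Next _ _) (≡ᵇ⇒≡ _ _ succ-k) (Next-% (toℕ<n k)))

Next⇒cycAdj : ∀ {p} (j k : Fin (suc p)) → Next (suc p) (toℕ j) (toℕ k) → cycAdj (suc p) j k ≡ true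
Next⇒cycAdj j k j↦k =
  ⇔.to T-≡ (⇔.from T-∨ (inj₁ (≡⇒≡ᵇ _ _ (Next-functional (Next-% (toℕ<n j)) j↦k))))

cycAdj-sym : ∀ m (j k : Fin m) → cycAdj m j k ≡ cycAdj m k j
cycAdj-sym (suc p) j k = ∨-comm ((suc (toℕ j) % suc p) ≡ᵇ toℕ k) _

next : ∀ {p} → Fin (suc p) → Fin (suc p)
next {p} j = fromℕ< (m%n<n (suc (toℕ j)) (suc p))

Next-next : ∀ {p} (j : Fin (suc p)) → Next (suc p) (toℕ j) (toℕ (next j))
Next-next j = subst (Next _ _) (sym (toℕ-fromℕ< _)) (Next-% (toℕ<n j))

cycAdj-next : ∀ {p} (j : Fin (suc p)) → cycAdj (suc p) j (next j) ≡ true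
cycAdj-next j = Next⇒cycAdj j (next j) (Next-next j)

next≢ : ∀ {p} (j : Fin (2 + p)) → next j ≢ j
next≢ j next-j≡j = Next-irreflexive (subst (Next _ _) (cong toℕ next-j≡j) (Next-next j))

cycAdj-triangle-free : ∀ {p} (j k l : Fin (4 + p)) → j ≢ k → k ≢ l → j ≢ l →
                       cycAdj _ j k ≡ true → cycAdj _ k l ≡ true → ¬ cycAdj _ j l ≡ true
cycAdj-triangle-free j k l j≢k k≢l j≢l j∼k k∼l j∼l
  with cycAdj⇒Next j k j∼k | cycAdj⇒Next k l k∼l | cycAdj⇒Next j l j∼l
... | inj₁ j↦k | inj₁ k↦l | inj₁ j↦l = k≢l (toℕ-injective (Next-functional j↦k j↦l))
... | inj₁ j↦k | inj₁ k↦l | inj₂ l↦j = Next-¬3-cycle j↦k k↦l l↦j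
... | inj₁ j↦k | inj₂ l↦k | _ = j≢l (toℕ-injective (Next-injective j↦k l↦k))
... | inj₂ k↦j | inj₁ k↦l | _ = j≢l (toℕ-injective (Next-functional k↦j k↦l))
... | inj₂ k↦j | inj₂ l↦k | inj₁ j↦l = Next-¬3-cycle k↦j j↦l l↦k
... | inj₂ k↦j | inj₂ l↦k | inj₂ l↦j = j≢k (sym (toℕ-injective (Next-functional l↦k l↦j)))

cycAdj-complete₃ : (j k : Fin 3) → j ≢ k → cycAdj 3 j k ≡ true
cycAdj-complete₃ 0F 0F 0≢0 = ⊥-elim (0≢0 refl)
cycAdj-complete₃ 0F 1F _ = refl
cycAdj-complete₃ 0F 2F _ = refl
cycAdj-complete₃ 1F 0F _ = refl
cycAdj-complete₃ 1F 1F 1≢1 = ⊥-elim (1≢1 refl)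
cycAdj-complete₃ 1F 2F _ = refl
cycAdj-complete₃ 2F 0F _ = refl
cycAdj-complete₃ 2F 1F _ = refl
cycAdj-complete₃ 2F 2F 2≢2 = ⊥-elim (2≢2 refl)

Fin3-third-unique : (j a b : Fin 3) → j ≢ 0F → a ≢ 0F → a ≢ j → b ≢ 0F → b ≢ j → a ≡ b
Fin3-third-unique 0F _ _ j≢0 _ _ _ _ = ⊥-elim (j≢0 refl)
Fin3-third-unique _ 0F _ _ a≢0 _ _ _ = ⊥-elim (a≢0 refl)
Fin3-third-unique _ _ 0F _ _ _ b≢0 _ = ⊥-elim (b≢0 refl)
Fin3-third-unique _ 1F 1F _ _ _ _ _ = refl
Fin3-third-unique _ 2F 2F _ _ _ _ _ = refl
Fin3-third-unique 1F 1F 2F _ _ a≢j _ _ = ⊥-elim (a≢j refl)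
Fin3-third-unique 1F 2F 1F _ _ _ _ b≢j = ⊥-elim (b≢j refl)
Fin3-third-unique 2F 1F 2F _ _ _ _ b≢j = ⊥-elim (b≢j refl)
Fin3-third-unique 2F 2F 1F _ _ a≢j _ _ = ⊥-elim (a≢j refl)

module Join (n′ m′ : ℕ) where

  n m : ℕ
  n = suc n′
  m = suc m′

  G : Graph
  G = W n m

  hub : Fin n → Fin (n + m)
  hub i = i ↑ˡ m

  rim : Fin m → Fin (n + m)
  rim j = n ↑ʳ j

  data HubOrRim : Fin (n + m) → Set where
    is-hub : ∀ i → HubOrRim (hub i)
    is-rim : ∀ j → HubOrRim (rim j)

  hubOrRim : ∀ x → HubOrRim x
  hubOrRim x with splitAt n x in eq
  ... | inj₁ i = subst HubOrRim (splitAt⁻¹-↑ˡ eq) (is-hub i)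
  ... | inj₂ j = subst HubOrRim (splitAt⁻¹-↑ʳ eq) (is-rim j)

  hub≢rim : ∀ {i j} → hub i ≢ rim j
  hub≢rim {i} {j} hub≡rim with () ←
    trans (sym (splitAt-↑ˡ n i m)) (trans (cong (splitAt n) hub≡rim) (splitAt-↑ʳ n m j))

  rim≢hub : ∀ {i j} → rim j ≢ hub i
  rim≢hub = hub≢rim ∘ sym

  rim-≢ : ∀ {j k} → j ≢ k → rim j ≢ rim k
  rim-≢ j≢k = j≢k ∘ ↑ʳ-injective n _ _

  hub∉⇒≢ : ∀ {S a i} → hub a ∉ S → hub i ∈ S → a ≢ i
  hub∉⇒≢ a∉ i∈ = ∉⇒≢ a∉ i∈ ∘ cong hub

  rim∉⇒≢ : ∀ {S a j} → rim a ∉ S → rim j ∈ S → a ≢ j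
  rim∉⇒≢ a∉ j∈ = ∉⇒≢ a∉ j∈ ∘ cong rim

  hub≁hub : ∀ i i′ → adj G (hub i) (hub i′) ≡ false
  hub≁hub i i′ rewrite splitAt-↑ˡ n i m | splitAt-↑ˡ n i′ m = refl

  hub∼rim : ∀ i j → Adj G (hub i) (rim j)
  hub∼rim i j rewrite splitAt-↑ˡ n i m | splitAt-↑ʳ n m j = refl

  rim∼hub : ∀ j i → Adj G (rim j) (hub i)
  rim∼hub j i rewrite splitAt-↑ʳ n m j | splitAt-↑ˡ n i m = refl

  adj-rim-rim : ∀ j k → adj G (rim j) (rim k) ≡ cycAdj m j k
  adj-rim-rim j k rewrite splitAt-↑ʳ n m j | splitAt-↑ʳ n m k = refl

  rim∼rim : ∀ j k → cycAdj m j k ≡ true → Adj G (rim j) (rim k)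
  rim∼rim j k = trans (adj-rim-rim j k)

  adj-sym : ∀ {x y} → Adj G x y → Adj G y x
  adj-sym {x} {y} x∼y with hubOrRim x | hubOrRim y
  ... | is-hub i | is-hub i′ with () ← trans (sym x∼y) (hub≁hub i i′)
  ... | is-hub i | is-rim j = rim∼hub j i
  ... | is-rim j | is-hub i = hub∼rim i j
  ... | is-rim j | is-rim k =
    rim∼rim k j (trans (cycAdj-sym m k j) (trans (sym (adj-rim-rim j k)) x∼y))

  walk≤2 : ∀ x y → Walk G x y 1 ⊎ Walk G x y 2
  walk≤2 x y with hubOrRim x | hubOrRim y
  ... | is-hub i | is-hub i′ = inj₂ (cons {y = rim 0F} (hub∼rim i 0F) (cons (rim∼hub 0F i′) nil))
  ... | is-hub i | is-rim j = inj₁ (cons (hub∼rim i j) nil)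
  ... | is-rim j | is-hub i = inj₁ (cons (rim∼hub j i) nil)
  ... | is-rim j | is-rim k = inj₂ (cons {y = hub 0F} (rim∼hub j 0F) (cons (hub∼rim 0F k) nil))

  open DiameterTwo (λ {x} {y} → adj-sym {x} {y}) walk≤2 public

  gp-unique-hub : ∀ {S i i′ j} → GeneralPosition G S → rim j ∈ S → hub i ∈ S → hub i′ ∈ S → i ≡ i′
  gp-unique-hub {i = i} {i′} {j} gp j∈ i∈ i′∈ with i Fin.≟ i′
  ... | yes i≡i′ = i≡i′
  ... | no i≢i′ = ⊥-elim (path-¬generalPosition i∈ j∈ i′∈ hub≢rim rim≢hub (i≢i′ ∘ ↑ˡ-injective m i i′)
                            (hub∼rim i j) (rim∼hub j i′) (hub≁hub i i′) gp)

  gp-rims-adjacent : ∀ {S i j k} → GeneralPosition G S → hub i ∈ S → rim j ∈ S → rim k ∈ S →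
                     j ≢ k → cycAdj m j k ≡ true
  gp-rims-adjacent {i = i} {j} {k} gp i∈ j∈ k∈ j≢k with cycAdj m j k in j≁k
  ... | true = refl
  ... | false = ⊥-elim (path-¬generalPosition j∈ i∈ k∈ rim≢hub hub≢rim (rim-≢ j≢k)
                          (rim∼hub j i) (hub∼rim i k) (trans (adj-rim-rim j k) j≁k) gp)

module LargeRim (n′ p : ℕ) where
  open Join n′ (3 + p)

  hub-rim-loses : ∀ {S} i j → hub i ∈ S → rim j ∈ S → ∃ (Legal G S) → ToMoveLoses G S
  hub-rim-loses {S} i j i∈ j∈ legal = loses-in-one legal blocked
    where
    blocked : ∀ u v → Legal G S u → ¬ Legal G (u ∷ S) v
    blocked u v (u∉ , gp-u) (v∉ , gp-v) with hubOrRim u | hubOrRim v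
    ... | is-hub a | _ = hub∉⇒≢ u∉ i∈ (gp-unique-hub gp-u (there j∈) (here refl) (there i∈))
    ... | is-rim a | is-hub b =
      hub∉⇒≢ v∉ (there i∈) (gp-unique-hub gp-v (there (there j∈)) (here refl) (there (there i∈)))
    ... | is-rim a | is-rim b =
      cycAdj-triangle-free j a b j≢a a≢b j≢b
        (gp-rims-adjacent gp-v i∈′ j∈′ a∈′ j≢a) (gp-rims-adjacent gp-v i∈′ a∈′ (here refl) a≢b)
        (gp-rims-adjacent gp-v i∈′ j∈′ (here refl) j≢b)
      where
      i∈′ = there (there i∈)
      j∈′ = there (there j∈)
      a∈′ = there (here refl)
      j≢a = ≢-sym (rim∉⇒≢ u∉ j∈)
      j≢b = ≢-sym (rim∉⇒≢ v∉ (there j∈))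
      a≢b = ≢-sym (rim∉⇒≢ v∉ (here refl))

  next∼ : ∀ j → Adj G (rim (next j)) (rim j)
  next∼ j = rim∼rim (next j) j (trans (cycAdj-sym _ (next j) j) (cycAdj-next j))

  b-wins : BWins G
  b-wins = stuck (hub 0F , clique-legal (λ ()) ([] ∷ [])) reply
    where
    reply : ∀ v → Legal G [] v → ToMoveWins G (v ∷ [])
    reply v _ with hubOrRim v
    ... | is-hub i =
      move (rim 0F) (clique-legal (All¬⇒¬Any (rim≢hub ∷ [])) ((rim∼hub 0F i ∷ []) ∷ [] ∷ []))
        (hub-rim-loses i 0F (there (here refl)) (here refl)
          (rim (next 0F) , clique-legal (All¬⇒¬Any (rim-≢ (next≢ 0F) ∷ rim≢hub ∷ []))
                             ((next∼ 0F ∷ rim∼hub (next 0F) i ∷ []) ∷ (rim∼hub 0F i ∷ []) ∷ [] ∷ [])))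
    ... | is-rim j =
      move (hub 0F) (clique-legal (All¬⇒¬Any (hub≢rim ∷ [])) ((hub∼rim 0F j ∷ []) ∷ [] ∷ []))
        (hub-rim-loses 0F j (here refl) (there (here refl))
          (rim (next j) , clique-legal (All¬⇒¬Any (rim≢hub ∷ rim-≢ (next≢ j) ∷ []))
                            ((rim∼hub (next j) 0F ∷ next∼ j ∷ []) ∷ (hub∼rim 0F j ∷ []) ∷ [] ∷ [])))

module TriangleRim (n′ : ℕ) where
  open Join n′ 2

  rim∼rim₃ : ∀ {j k} → j ≢ k → Adj G (rim j) (rim k)
  rim∼rim₃ {j} {k} j≢k = rim∼rim j k (cycAdj-complete₃ j k j≢k)

  hub-two-rims-loses : ∀ {S} i j → j ≢ 0F → hub i ∈ S → rim 0F ∈ S → rim j ∈ S →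
                       ∃ (Legal G S) → ToMoveLoses G S
  hub-two-rims-loses {S} i j j≢0 i∈ 0∈ j∈ legal = loses-in-one legal blocked
    where
    blocked : ∀ u v → Legal G S u → ¬ Legal G (u ∷ S) v
    blocked u v (u∉ , gp-u) (v∉ , gp-v) with hubOrRim u | hubOrRim v
    ... | is-hub a | _ = hub∉⇒≢ u∉ i∈ (gp-unique-hub gp-u (there 0∈) (here refl) (there i∈))
    ... | is-rim a | is-hub b =
      hub∉⇒≢ v∉ (there i∈) (gp-unique-hub gp-v (there (there 0∈)) (here refl) (there (there i∈)))
    ... | is-rim a | is-rim b =
      rim∉⇒≢ v∉ (here refl)
        (Fin3-third-unique j b a j≢0 (rim∉⇒≢ v∉ (there 0∈)) (rim∉⇒≢ v∉ (there j∈))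
                                     (rim∉⇒≢ u∉ 0∈) (rim∉⇒≢ u∉ j∈))

  a-wins : ToMoveWins G []
  a-wins = move (rim 0F) (clique-legal (λ ()) ([] ∷ []))
                (stuck (hub 0F , clique-legal (All¬⇒¬Any (hub≢rim ∷ [])) ((hub∼rim 0F 0F ∷ []) ∷ [] ∷ [])) reply)
    where
    hub-reply : ∀ j k → j ≢ 0F → k ≢ 0F → k ≢ j → ToMoveWins G (rim j ∷ rim 0F ∷ [])
    hub-reply j k j≢0 k≢0 k≢j =
      move (hub 0F)
        (clique-legal (All¬⇒¬Any (hub≢rim ∷ hub≢rim ∷ []))
          ((hub∼rim 0F j ∷ hub∼rim 0F 0F ∷ []) ∷ (rim∼rim₃ j≢0 ∷ []) ∷ [] ∷ []))
        (hub-two-rims-loses 0F j j≢0 (here refl) (there (there (here refl))) (there (here refl))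
          (rim k , clique-legal (All¬⇒¬Any (rim≢hub ∷ rim-≢ k≢j ∷ rim-≢ k≢0 ∷ []))
            ((rim∼hub k 0F ∷ rim∼rim₃ k≢j ∷ rim∼rim₃ k≢0 ∷ []) ∷
             (hub∼rim 0F j ∷ hub∼rim 0F 0F ∷ []) ∷ (rim∼rim₃ j≢0 ∷ []) ∷ [] ∷ [])))

    reply : ∀ v → Legal G (rim 0F ∷ []) v → ToMoveWins G (v ∷ rim 0F ∷ [])
    reply v (v∉ , _) with hubOrRim v
    ... | is-hub i =
      move (rim 1F)
        (clique-legal (All¬⇒¬Any (rim≢hub ∷ rim-≢ (λ ()) ∷ []))
          ((rim∼hub 1F i ∷ rim∼rim₃ (λ ()) ∷ []) ∷ (hub∼rim i 0F ∷ []) ∷ [] ∷ []))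
        (hub-two-rims-loses i 1F (λ ()) (there (here refl)) (there (there (here refl))) (here refl)
          (rim 2F , clique-legal (All¬⇒¬Any (rim-≢ (λ ()) ∷ rim≢hub ∷ rim-≢ (λ ()) ∷ []))
            ((rim∼rim₃ (λ ()) ∷ rim∼hub 2F i ∷ rim∼rim₃ (λ ()) ∷ []) ∷
             (rim∼hub 1F i ∷ rim∼rim₃ (λ ()) ∷ []) ∷ (hub∼rim i 0F ∷ []) ∷ [] ∷ [])))
    ... | is-rim 0F = ⊥-elim (v∉ (here refl))
    ... | is-rim 1F = hub-reply 1F 2F (λ ()) (λ ()) (λ ())
    ... | is-rim 2F = hub-reply 2F 1F (λ ()) (λ ()) (λ ())

theorem2p6 : ∀ (n m : ℕ) → 1 ≤ n → 3 ≤ m → (BWins (W n m) ⇔ 4 ≤ m)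
theorem2p6 (suc n′) 3 _ _ =
  mk⇔ (λ b-wins → ⊥-elim (wins⇒¬loses (TriangleRim.a-wins n′) b-wins))
      (λ 4≤3 → ⊥-elim (<-irrefl refl 4≤3))
theorem2p6 (suc n′) (suc (suc (suc (suc p)))) _ _ = mk⇔ (λ _ → m≤m+n 4 p) (λ _ → LargeRim.b-wins n′ p)
theorem2p6 0 _ () _
theorem2p6 (suc _) 0 _ ()
theorem2p6 (suc _) 1 _ (s≤s ())
theorem2p6 (suc _) 2 _ (s≤s (s≤s ()))
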